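{- Let $S\subseteq \mathbb{N}^d$ be a generalized numerical semigroup and let $S_1,\ldots,S_n$ be generalized numerical semigroups in $\mathbb{N}^d$ each containing $S$. The following are equivalent: (1) $S=S_1\cap\cdots\cap S_n$; (2) for every $\mathbf{h}\in EH(S)$ there exists $i\in\{1,\ldots,n\}$ with $\mathbf{h}\notin S_i$; (3) $\mathcal{C}(S_1)\cup\cdots\cup\mathcal{C}(S_n)=EH(S)$.
   Context: A generalized numerical semigroup (GNS) is a submonoid $S\subseteq\mathbb{N}^d$ such that $H(S)=\mathbb{N}^d\setminus S$ is finite. $EH(S)=\{\mathbf{x}\in H(S)\mid 2\mathbf{x}\in S \text{ and } \mathbf{x}+\mathbf{s}\in S \text{ for all } \mathbf{s}\in S\setminus\{\mathbf{0}\}\}$. For a GNS $T\supseteq S$, $\mathcal{C}(T)=\{\mathbf{h}\in EH(S)\mid \mathbf{h}\notin T\}$. -}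

module Defs where

open import Data.Nat using (ℕ; _+_)
open import Data.Bool using (Bool; true)
open import Data.Vec using (Vec; zipWith; replicate)
open import Data.List using (List)
open import Data.List.Membership.Propositional using () renaming (_∈_ to _∈ᴸ_)
open import Data.Product using (Σ; _×_)
open import Relation.Nullary using (¬_)
open import Relation.Binary.PropositionalEquality using (_≡_)

Point : ℕ → Set
Point d = Vec ℕ d

_⊕_ : ∀ {d} → Point d → Point d → Point d
_⊕_ = zipWith _+_

𝟎 : ∀ {d} → Point d
𝟎 {d} = replicate d 0

SubsetN : ℕ → Set
SubsetN d = Point d → Bool

_∈ˢ_ : ∀ {d} → Point d → SubsetN d → Set
x ∈ˢ S = S x ≡ true

_∉ˢ_ : ∀ {d} → Point d → SubsetN d → Set
x ∉ˢ S = ¬ (x ∈ˢ S)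

record IsGNS {d : ℕ} (S : SubsetN d) : Set where
  field
    zero∈    : 𝟎 ∈ˢ S
    closed   : ∀ x y → x ∈ˢ S → y ∈ˢ S → (x ⊕ y) ∈ˢ S
    finiteH  : Σ (List (Point d)) (λ L → ∀ x → x ∉ˢ S → x ∈ᴸ L)

H : ∀ {d} → SubsetN d → Point d → Set
H S x = x ∉ˢ S

EH : ∀ {d} → SubsetN d → Point d → Set
EH S x = H S x × (x ⊕ x) ∈ˢ S × (∀ s → s ∈ˢ S → ¬ (s ≡ 𝟎) → (x ⊕ s) ∈ˢ S)

𝒞 : ∀ {d} → SubsetN d → SubsetN d → Point d → Set
𝒞 S T h = EH S h × h ∉ˢ T

module Submission where

-- Measure a point of ℕ^d by its size |x| (sum of coordinates);
-- adding a nonzero point strictly increases the size, and since H(S) is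
-- finite, the sizes of the holes of S are bounded.  The central fact is:
--
--   if T ⊇ S is closed under addition and contains no element of EH(S),
--   then T ⊆ S.
--
-- Indeed, a hole y of S lying in T whose size is maximal among such holes
-- belongs to EH(S): 2y and y + s (s ∈ S nonzero) lie in T and are larger
-- than y, hence lie in S.
-- Applied to T = S₁ ∩ ⋯ ∩ Sₙ this gives (2) ⇒ (1); the implication
-- (1) ⇒ (2) holds because an element of EH(S) is a hole of S, and (2) ⇔ (3)
-- is a reformulation, as 𝒞(Sᵢ) consists of the points of EH(S) outside Sᵢ.

open import Defs
open import Data.Nat using (ℕ; zero; suc; _+_; _∸_; _≤_; _<_)
open import Data.Nat.Properties
  using (+-commutativeSemigroup; ≤-trans; m≤m+n; m≤n+m; m<m+n; n≢0⇒n>0; ∸-monoʳ-<)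
open import Data.Nat.Induction using (<-wellFounded)
open import Algebra.Properties.CommutativeSemigroup +-commutativeSemigroup using (interchange)
open import Data.Fin using (Fin)
open import Data.Fin.Properties using (¬∀⟶∃¬)
open import Data.Product using (Σ; _×_; _,_; proj₁; proj₂)
open import Data.Vec using ([]; _∷_; sum)
open import Data.List using (List; []; _∷_)
open import Data.List.Relation.Unary.Any using (here; there)
open import Data.List.Membership.Propositional using () renaming (_∈_ to _∈ᴸ_)
open import Data.Bool using (true)
open import Data.Bool.Properties using (_≟_)
open import Function.Bundles using (_⇔_; mk⇔; Equivalence)
open import Induction.WellFounded using (Acc; acc)
import Relation.Binary.Construct.On as On
open import Relation.Nullary using (Dec; ¬_; yes; no; contradiction)
open import Relation.Binary.PropositionalEquality using (_≡_; refl; cong)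

_∈ˢ?_ : ∀ {d} (x : Point d) (S : SubsetN d) → Dec (x ∈ˢ S)
x ∈ˢ? S = S x ≟ true

∣_∣ : ∀ {d} → Point d → ℕ
∣ x ∣ = sum x

∣⊕∣ : ∀ {d} (x y : Point d) → ∣ x ⊕ y ∣ ≡ ∣ x ∣ + ∣ y ∣
∣⊕∣ []      []      = refl
∣⊕∣ (a ∷ x) (b ∷ y) rewrite ∣⊕∣ x y = interchange a b ∣ x ∣ ∣ y ∣

size-zero : ∀ {d} (x : Point d) → ∣ x ∣ ≡ 0 → x ≡ 𝟎
size-zero []          _ = refl
size-zero (zero ∷ x) e = cong (0 ∷_) (size-zero x e)

⊕-grows : ∀ {d} (y s : Point d) → ¬ (s ≡ 𝟎) → ∣ y ∣ < ∣ y ⊕ s ∣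
⊕-grows y s s≢𝟎 rewrite ∣⊕∣ y s =
  m<m+n ∣ y ∣ (n≢0⇒n>0 (λ ∣s∣≡0 → s≢𝟎 (size-zero s ∣s∣≡0)))

listSize : ∀ {d} → List (Point d) → ℕ
listSize []       = 0
listSize (y ∷ ys) = ∣ y ∣ + listSize ys

member-size≤ : ∀ {d} {x : Point d} (ys : List (Point d)) → x ∈ᴸ ys → ∣ x ∣ ≤ listSize ys
member-size≤ (y ∷ ys) (here refl) = m≤m+n ∣ y ∣ (listSize ys)
member-size≤ (y ∷ ys) (there x∈) = ≤-trans (member-size≤ ys x∈) (m≤n+m (listSize ys) ∣ y ∣)

module OverMonoid {d : ℕ} {S : SubsetN d} (S-gns : IsGNS S) (T : Point d → Set)
                  (S⊆T : ∀ x → x ∈ˢ S → T x)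
                  (T-closed : ∀ x y → T x → T y → T (x ⊕ y)) where

  open IsGNS S-gns

  -- Since H(S) is finite, the total size of its enumeration bounds the
  -- size of every hole of S.
  holeBound : ℕ
  holeBound = listSize (proj₁ finiteH)

  hole-size≤ : ∀ x → x ∉ˢ S → ∣ x ∣ ≤ holeBound
  hole-size≤ x x∉S = member-size≤ (proj₁ finiteH) (proj₂ finiteH x x∉S)

  maximal-hole-special : ∀ y → T y → y ∉ˢ S →
    (∀ z → ∣ y ∣ < ∣ z ∣ → T z → z ∈ˢ S) → EH S y
  maximal-hole-special y y∈T y∉S above =
      y∉S
    , above (y ⊕ y) (⊕-grows y y y≢𝟎) (T-closed y y y∈T y∈T)
    , λ s s∈S s≢𝟎 → above (y ⊕ s) (⊕-grows y s s≢𝟎) (T-closed y s y∈T (S⊆T s s∈S))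
    where
    y≢𝟎 : ¬ (y ≡ 𝟎)
    y≢𝟎 refl = y∉S zero∈

  -- Points of larger size are closer to the hole bound; this order is
  -- well founded.
  _≺_ : Point d → Point d → Set
  z ≺ y = holeBound ∸ ∣ z ∣ < holeBound ∸ ∣ y ∣

  avoiding-EH⇒⊆S : (∀ h → EH S h → ¬ T h) → ∀ x → T x → x ∈ˢ S
  avoiding-EH⇒⊆S avoid x = go x (On.wellFounded (λ y → holeBound ∸ ∣ y ∣) <-wellFounded x)
    where
    go : ∀ y → Acc _≺_ y → T y → y ∈ˢ S
    go y (acc rec) y∈T with y ∈ˢ? S
    ... | yes y∈S = y∈S
    ... | no  y∉S = contradiction y∈T (avoid y (maximal-hole-special y y∈T y∉S above))
      where
      above : ∀ z → ∣ y ∣ < ∣ z ∣ → T z → z ∈ˢ S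
      above z y<z z∈T with z ∈ˢ? S
      ... | yes z∈S = z∈S
      ... | no  z∉S = go z (rec (∸-monoʳ-< y<z (hole-size≤ z z∉S))) z∈T

mainTheorem13 : (d n : ℕ) (S : SubsetN d) → IsGNS S →
    (Ss : Fin n → SubsetN d) → (∀ i → IsGNS (Ss i)) →
    (∀ i x → x ∈ˢ S → x ∈ˢ Ss i) →
    let c1 = ∀ x → (x ∈ˢ S) ⇔ (∀ i → x ∈ˢ Ss i)
        c2 = ∀ h → EH S h → Σ (Fin n) (λ i → h ∉ˢ Ss i)
        c3 = ∀ h → (Σ (Fin n) (λ i → 𝒞 S (Ss i) h)) ⇔ EH S h
    in (c1 ⇔ c2) × (c2 ⇔ c3)
mainTheorem13 d n S S-gns Ss Ss-gns S⊆Sᵢ =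
  mk⇔ intersection⇒missed missed⇒intersection , mk⇔ missed⇒cover cover⇒missed
  where
  ⋂Ss : Point d → Set
  ⋂Ss x = ∀ i → x ∈ˢ Ss i

  IsIntersection Misses Covers : Set
  IsIntersection = ∀ x → (x ∈ˢ S) ⇔ ⋂Ss x
  Misses = ∀ h → EH S h → Σ (Fin n) (λ i → h ∉ˢ Ss i)
  Covers = ∀ h → (Σ (Fin n) (λ i → 𝒞 S (Ss i) h)) ⇔ EH S h

  -- (1) ⇒ (2): a special gap is a hole of S, hence outside some Sᵢ.
  intersection⇒missed : IsIntersection → Misses
  intersection⇒missed eq h h∈EH =
    ¬∀⟶∃¬ n (λ i → h ∈ˢ Ss i) (λ i → h ∈ˢ? Ss i)
      (λ h∈⋂ → proj₁ h∈EH (Equivalence.from (eq h) h∈⋂))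

  -- (2) ⇒ (1): the intersection is an over-monoid of S avoiding EH(S).
  missed⇒intersection : Misses → IsIntersection
  missed⇒intersection missed x = mk⇔ (λ x∈S i → S⊆Sᵢ i x x∈S)
    (OverMonoid.avoiding-EH⇒⊆S S-gns ⋂Ss
      (λ y y∈S i → S⊆Sᵢ i y y∈S)
      (λ y z y∈⋂ z∈⋂ i → IsGNS.closed (Ss-gns i) y z (y∈⋂ i) (z∈⋂ i))
      (λ h h∈EH h∈⋂ → let (i , h∉Sᵢ) = missed h h∈EH in h∉Sᵢ (h∈⋂ i))
      x)

  missed⇒cover : Misses → Covers
  missed⇒cover missed h = mk⇔ (λ (_ , h∈EH , _) → h∈EH)
    (λ h∈EH → let (i , h∉Sᵢ) = missed h h∈EH in i , h∈EH , h∉Sᵢ)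

  cover⇒missed : Covers → Misses
  cover⇒missed cover h h∈EH = let (i , _ , h∉Sᵢ) = Equivalence.from (cover h) h∈EH in i , h∉Sᵢ
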